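{- Let $R=\langle s,r_1,r_2,\ldots\rangle$ and $a$ be as in the context. Then $a(n)=0$ for $n<s$, and for every $n\ge s$, $$a(n)=n-s-\sum_{i,j\ge 1}c_{i,j}\,a^{i}(n-j),$$ where $a^i$ denotes the $i$-fold composition of $a$, $r_{i,j}=1$ if $r_i\ge j$ and $r_{i,j}=0$ otherwise (for $i,j\ge0$, with the convention $r_0=-1$), and $c_{i,j}=r_{i,j}-r_{i-1,j}$.
   Context: Let $R=\langle s,r_1,r_2,\ldots\rangle$ be a sequence of nonnegative integers with $s\ge 1$. Let $\Sigma=\{\mathtt r,\mathtt 0,\mathtt 1,\mathtt 2,\ldots\}$ be the infinite alphabet consisting of a letter $\mathtt r$ together with a letter $[j]$ for each integer $j\ge 0$. For a letter $\mathtt x$ and $m\ge0$, $\mathtt x^m$ is the word of $m$ copies of $\mathtt x$. Let $\sigma$ be the morphism of words over $\Sigma$ defined by $\sigma(\mathtt r)=\mathtt r\,\mathtt 0^{s}$ and $\sigma([j])=[j+1]\,\mathtt 0^{r_{j+1}}$ for $j\ge 0$. Let $\mathcal T$ be the infinite rooted ordered tree whose root is labelled $\mathtt r$ and in which the labels of the children of any node labelled $\mathtt x$, read left to right, spell $\sigma(\mathtt x)$. For a node $v$, $\ell(v)$ is the number of nodes in the same row (depth) as $v$ lying strictly to its left. Define $a:\mathbb Z\to\mathbb Z_{\ge0}$ by $a(n)=0$ for $n<0$ and $a(\ell(v))=\ell(\mathrm{parent}(v))$ for every non-root node $v$ of $\mathcal T$ (this is well defined). -}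

module Defs where

open import Data.Nat as ℕ using (ℕ; zero; suc; _≤ᵇ_)
open import Data.Integer as ℤ using (ℤ; +_; 0ℤ; 1ℤ)
open import Data.List using (List; []; _∷_; _++_; map; replicate; length; lookup)
open import Data.Product using (_×_; _,_; proj₁; proj₂)
open import Data.Fin using (fromℕ<)
open import Data.Bool using (if_then_else_)
open import Relation.Binary.PropositionalEquality using (_≡_)

-- The sequence R = ⟨s, r₁, r₂, …⟩ is given by  s : ℕ  and  r : ℕ → ℕ,
-- where r_i = r i for i ≥ 1 (the value  r 0  is never used).

-- The alphabet Σ = {r, 0, 1, 2, …}:  rl  is the letter r,  num j  is [j].
data Letter : Set where
  rl  : Letter
  num : ℕ → Letter

σ : (s : ℕ) (r : ℕ → ℕ) → Letter → List Letter
σ s r rl      = rl ∷ replicate s (num 0)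
σ s r (num j) = num (suc j) ∷ replicate (r (suc j)) (num 0)

-- Given a row (list of labels, left to right), the next row of the tree:
-- the children of each node in order, each tagged with the position ℓ of
-- its parent in the given row (p is the position of the first listed node).
children : (s : ℕ) (r : ℕ → ℕ) → ℕ → List Letter → List (Letter × ℕ)
children s r p []       = []
children s r p (x ∷ xs) = map (λ y → y , p) (σ s r x) ++ children s r (suc p) xs

row : (s : ℕ) (r : ℕ → ℕ) → ℕ → List Letter
row s r zero    = rl ∷ []
row s r (suc d) = map proj₁ (children s r 0 (row s r d))

-- Row d+1 with parent positions:  nextRow s r d  has as k-th entry
-- (label of the node v at depth d+1 with ℓ(v) = k , ℓ(parent v)).
nextRow : (s : ℕ) (r : ℕ → ℕ) → ℕ → List (Letter × ℕ)
nextRow s r d = children s r 0 (row s r d)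

-- The defining property of a : ℤ → ℤ≥0:  a(n) = 0 for n < 0, and
-- a(ℓ(v)) = ℓ(parent v) for every non-root node v (at depth d+1, position k).
IsA : (s : ℕ) (r : ℕ → ℕ) → (ℤ → ℕ) → Set
IsA s r a =
  ((n : ℤ) → n ℤ.< 0ℤ → a n ≡ 0) ×
  ((d k : ℕ) (h : k ℕ.< length (nextRow s r d)) →
     a (+ k) ≡ proj₂ (lookup (nextRow s r d) (fromℕ< h)))

iter : (ℤ → ℕ) → ℕ → ℤ → ℤ
iter a zero    x = x
iter a (suc i) x = + a (iter a i x)

-- r_{i,j} = 1 if r_i ≥ j and 0 otherwise, with r_0 = -1 (so r_{0,j} = 0 for j ≥ 0).
rr : (r : ℕ → ℕ) → ℕ → ℕ → ℤ
rr r zero    j = 0ℤ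
rr r (suc i) j = if j ≤ᵇ r (suc i) then 1ℤ else 0ℤ

c : (r : ℕ → ℕ) → ℕ → ℕ → ℤ
c r zero    j = 0ℤ   -- never used (i ranges over i ≥ 1)
c r (suc i) j = rr r (suc i) j ℤ.- rr r i j

sum1 : ℕ → (ℕ → ℤ) → ℤ
sum1 zero    f = 0ℤ
sum1 (suc N) f = sum1 N f ℤ.+ f (suc N)

-- The rows of 𝒯 are prefixes of one another (every row starts with r), so together they spell
-- one infinite word w, and a(q) is the position of the parent of the letter w(q). The children of
-- a node form a block: a nonzero first letter followed by a run of 0s whose length depends only on
-- the parent's label. Hence a(n+1) = a(n) + 1 − [w(n+1) = 0]. A letter [j] (with r counted as [0])
-- ends a chain of j first children, so a^i(n+1) = a^i(n) + [i ≤ j] when w(n+1) = [j]. Summed against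
-- c_{i,j} this telescopes in i to r_{j',j}, where w(n+1−j) = [j'], and that is 1 exactly when the run
-- of 0s following position n+1−j reaches n+1. Beyond position s these runs partition the 0s, so the
-- double sum grows by [w(n+1) = 0] at each step, and induction from a(s) = 0 gives the formula.

module Submission where

open import Defs
open import Data.Bool using (true; false; if_then_else_)
open import Data.Empty using (⊥-elim)
open import Data.Fin using (fromℕ<)
open import Data.Integer as ℤ using (ℤ; +_; -[1+_]; 0ℤ; 1ℤ; _*_; _-_)
import Data.Integer.Properties as ℤP
open import Data.Integer.Solver using (module +-*-Solver)
open import Data.List using (List; []; _∷_; _++_; map; replicate; length; lookup)
import Data.List.Properties as ListP
open import Data.Nat as ℕ using (ℕ; zero; suc; z≤n; s≤s; _+_; _∸_; _⊓_; _≤_; _<_; _≤′_; _≤ᵇ_; _≤?_; _≟_)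
open import Data.Nat.Induction using (<-rec)
import Data.Nat.Properties as ℕP
open import Data.Product using (∃-syntax; _×_; _,_; proj₁; proj₂)
open import Data.Sum using (_⊎_; inj₁; inj₂)
open import Relation.Nullary using (Dec; yes; no)
open import Relation.Binary.Definitions using (tri<; tri≈; tri>)
open import Relation.Binary.PropositionalEquality
  using (_≡_; _≢_; refl; sym; trans; cong; cong₂; subst; module ≡-Reasoning)

module _ {A : Set} (default : A) where

  -- Out-of-range positions yield the default; every use below is guarded by a length bound.
  nth : List A → ℕ → A
  nth []       k       = default
  nth (x ∷ xs) zero    = x
  nth (x ∷ xs) (suc k) = nth xs k

  lookup≡nth : ∀ xs k (h : k < length xs) → lookup xs (fromℕ< h) ≡ nth xs k
  lookup≡nth (x ∷ xs) zero    h       = refl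
  lookup≡nth (x ∷ xs) (suc k) (s≤s h) = lookup≡nth xs k h

  nth-++ˡ : ∀ xs ys k → k < length xs → nth (xs ++ ys) k ≡ nth xs k
  nth-++ˡ (x ∷ xs) ys zero    h       = refl
  nth-++ˡ (x ∷ xs) ys (suc k) (s≤s h) = nth-++ˡ xs ys k h

  nth-replicate-++ : ∀ n y ys k → k < n → nth (replicate n y ++ ys) k ≡ y
  nth-replicate-++ (suc n) y ys zero    h       = refl
  nth-replicate-++ (suc n) y ys (suc k) (s≤s h) = nth-replicate-++ n y ys k h

  nth-replicate-++-end : ∀ n y ys → nth (replicate n y ++ ys) n ≡ nth ys 0
  nth-replicate-++-end zero    y ys = refl
  nth-replicate-++-end (suc n) y ys = nth-replicate-++-end n y ys

nth-map : {A B : Set} (f : A → B) (d : A) → ∀ xs k → nth (f d) (map f xs) k ≡ f (nth d xs k)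
nth-map f d []       k       = refl
nth-map f d (x ∷ xs) zero    = refl
nth-map f d (x ∷ xs) (suc k) = nth-map f d xs k

length-replicate-++ : {A : Set} (n : ℕ) (y : A) (ys : List A) → length (replicate n y ++ ys) ≡ n + length ys
length-replicate-++ n y ys = trans (ListP.length-++ (replicate n y)) (cong (_+ length ys) (ListP.length-replicate n))

Prefix : {A : Set} → List A → List A → Set
Prefix xs zs = ∃[ ys ] zs ≡ xs ++ ys

sum1-cong : ∀ N {f g : ℕ → ℤ} → (∀ k → 1 ≤ k → k ≤ N → f k ≡ g k) → sum1 N f ≡ sum1 N g
sum1-cong zero    f≡g = refl
sum1-cong (suc N) f≡g =
  cong₂ ℤ._+_ (sum1-cong N (λ k k≥1 k≤N → f≡g k k≥1 (ℕP.m≤n⇒m≤1+n k≤N)))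
              (f≡g (suc N) (s≤s z≤n) ℕP.≤-refl)

sum1-zero : ∀ N {f : ℕ → ℤ} → (∀ k → 1 ≤ k → k ≤ N → f k ≡ 0ℤ) → sum1 N f ≡ 0ℤ
sum1-zero zero    f≡0 = refl
sum1-zero (suc N) f≡0 =
  cong₂ ℤ._+_ (sum1-zero N (λ k k≥1 k≤N → f≡0 k k≥1 (ℕP.m≤n⇒m≤1+n k≤N)))
              (f≡0 (suc N) (s≤s z≤n) ℕP.≤-refl)

sum1-+ : ∀ N (f g : ℕ → ℤ) → sum1 N (λ k → f k ℤ.+ g k) ≡ sum1 N f ℤ.+ sum1 N g
sum1-+ zero    f g = refl
sum1-+ (suc N) f g = trans (cong (ℤ._+ (f (suc N) ℤ.+ g (suc N))) (sum1-+ N f g))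
  (solve 4 (λ x y z w → (x :+ y) :+ (z :+ w) := (x :+ z) :+ (y :+ w)) refl (sum1 N f) (sum1 N g) (f (suc N)) (g (suc N)))
  where open +-*-Solver

sum1-swap : ∀ N M (f : ℕ → ℕ → ℤ) → sum1 N (λ i → sum1 M (f i)) ≡ sum1 M (λ j → sum1 N (λ i → f i j))
sum1-swap zero    M f = sym (sum1-zero M (λ _ _ _ → refl))
sum1-swap (suc N) M f = trans (cong (ℤ._+ sum1 M (f (suc N))) (sum1-swap N M f))
  (sym (sum1-+ M (λ j → sum1 N (λ i → f i j)) (f (suc N))))

sum1-single : ∀ N {f : ℕ → ℤ} j₀ → 1 ≤ j₀ → j₀ ≤ N →
  (∀ j → 1 ≤ j → j ≤ N → j ≢ j₀ → f j ≡ 0ℤ) → sum1 N f ≡ f j₀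
sum1-single zero    (suc _) _ () _
sum1-single (suc N) {f} j₀ j₀≥1 j₀≤ f≡0 with j₀ ≟ suc N
... | yes refl = trans (cong (ℤ._+ f (suc N)) (sum1-zero N below)) (ℤP.+-identityˡ _)
  where below : ∀ k → 1 ≤ k → k ≤ N → f k ≡ 0ℤ
        below k k≥1 k≤N = f≡0 k k≥1 (ℕP.m≤n⇒m≤1+n k≤N) (λ k≡ → ℕP.<-irrefl k≡ (s≤s k≤N))
... | no  j₀≢ = trans (cong₂ ℤ._+_ (sum1-single N j₀ j₀≥1 (ℕP.≤-pred (ℕP.≤∧≢⇒< j₀≤ j₀≢)) below)
                                    (f≡0 (suc N) (s≤s z≤n) ℕP.≤-refl (λ e → j₀≢ (sym e))))
                     (ℤP.+-identityʳ _)
  where below : ∀ k → 1 ≤ k → k ≤ N → k ≢ j₀ → f k ≡ 0ℤ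
        below k k≥1 k≤N = f≡0 k k≥1 (ℕP.m≤n⇒m≤1+n k≤N)

𝟙≤ : ℕ → ℕ → ℤ
𝟙≤ m n = if m ≤ᵇ n then 1ℤ else 0ℤ

𝟙≤-≤ : ∀ {m n} → m ≤ n → 𝟙≤ m n ≡ 1ℤ
𝟙≤-≤ {m} {n} m≤n with m ≤ᵇ n | ℕP.≤⇒≤ᵇ m≤n
... | true | _ = refl

𝟙≤-> : ∀ {m n} → n < m → 𝟙≤ m n ≡ 0ℤ
𝟙≤-> {m} {n} n<m with m ≤ᵇ n | ℕP.≤ᵇ⇒≤ m n
... | true  | m≤n = ⊥-elim (ℕP.<⇒≱ n<m (m≤n _))
... | false | _   = refl

𝟙≤-suc : ∀ m n → 𝟙≤ (suc m) (suc n) ≡ 𝟙≤ m n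
𝟙≤-suc zero    n = refl
𝟙≤-suc (suc m) n = refl

sum1-telescope-𝟙≤ : ∀ (g : ℕ → ℤ) N K →
  sum1 N (λ i → (g i - g (ℕ.pred i)) * 𝟙≤ i K) ≡ g (K ⊓ N) - g 0
sum1-telescope-𝟙≤ g zero    K = sym (trans (cong (λ k → g k - g 0) (ℕP.m≥n⇒m⊓n≡n z≤n)) (ℤP.+-inverseʳ (g 0)))
sum1-telescope-𝟙≤ g (suc N) K with suc N ≤? K
... | yes N<K = begin
    sum1 N _ ℤ.+ Δ * 𝟙≤ (suc N) K
  ≡⟨ cong₂ (λ x y → x ℤ.+ Δ * y) (sum1-telescope-𝟙≤ g N K) (𝟙≤-≤ N<K) ⟩
    g (K ⊓ N) - g 0 ℤ.+ Δ * 1ℤ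
  ≡⟨ cong (λ k → g k - g 0 ℤ.+ Δ * 1ℤ) (ℕP.m≥n⇒m⊓n≡n (ℕP.<⇒≤ N<K)) ⟩
    g N - g 0 ℤ.+ (g (suc N) - g N) * 1ℤ
  ≡⟨ solve 3 (λ x y z → x :- y :+ (z :- x) :* con 1ℤ := z :- y) refl (g N) (g 0) (g (suc N)) ⟩
    g (suc N) - g 0
  ≡⟨ cong (λ k → g k - g 0) (sym (ℕP.m≥n⇒m⊓n≡n N<K)) ⟩
    g (K ⊓ suc N) - g 0
  ∎
  where open ≡-Reasoning; open +-*-Solver
        Δ = g (suc N) - g N
... | no  N≮K = begin
    sum1 N _ ℤ.+ Δ * 𝟙≤ (suc N) K
  ≡⟨ cong₂ (λ x y → x ℤ.+ Δ * y) (sum1-telescope-𝟙≤ g N K) (𝟙≤-> K<N) ⟩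
    g (K ⊓ N) - g 0 ℤ.+ Δ * 0ℤ
  ≡⟨ cong (λ x → g (K ⊓ N) - g 0 ℤ.+ x) (ℤP.*-zeroʳ Δ) ⟩
    g (K ⊓ N) - g 0 ℤ.+ 0ℤ
  ≡⟨ ℤP.+-identityʳ _ ⟩
    g (K ⊓ N) - g 0
  ≡⟨ cong (λ k → g k - g 0) (trans (ℕP.m≤n⇒m⊓n≡m K≤N) (sym (ℕP.m≤n⇒m⊓n≡m (ℕP.m≤n⇒m≤1+n K≤N)))) ⟩
    g (K ⊓ suc N) - g 0
  ∎
  where open ≡-Reasoning
        Δ = g (suc N) - g N
        K<N = ℕP.≰⇒> N≮K
        K≤N = ℕP.≤-pred K<N

[+m]-[+n]≡+[m∸n] : ∀ {m n} → n ≤ m → + m - + n ≡ + (m ∸ n)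
[+m]-[+n]≡+[m∸n] {m} {n} n≤m = trans (ℤP.[+m]-[+n]≡m⊖n m n) (ℤP.⊖-≥ n≤m)

[+m]-[+n]≡-[n∸m] : ∀ {m n} → m ≤ n → + m - + n ≡ ℤ.- + (n ∸ m)
[+m]-[+n]≡-[n∸m] {m} {n} m≤n = trans (ℤP.[+m]-[+n]≡m⊖n m n) (ℤP.⊖-≤ m≤n)

[+1+m]-[+n]≡[+m]-[+n]+1 : ∀ m n → + suc m - + n ≡ (+ m - + n) ℤ.+ 1ℤ
[+1+m]-[+n]≡[+m]-[+n]+1 m n = solve 2 (λ x y → (con 1ℤ :+ x) :- y := (x :- y) :+ con 1ℤ) refl (+ m) (+ n)
  where open +-*-Solver

c-telescope : ∀ (r : ℕ → ℕ) N j K → K ≤ N → sum1 N (λ i → c r i j * 𝟙≤ i K) ≡ rr r K j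
c-telescope r N j K K≤N = begin
    sum1 N (λ i → c r i j * 𝟙≤ i K)                           ≡⟨ sum1-cong N (λ { (suc i) _ _ → refl }) ⟩
    sum1 N (λ i → (rr r i j - rr r (ℕ.pred i) j) * 𝟙≤ i K)    ≡⟨ sum1-telescope-𝟙≤ (λ i → rr r i j) N K ⟩
    rr r (K ⊓ N) j - 0ℤ                                        ≡⟨ ℤP.+-identityʳ _ ⟩
    rr r (K ⊓ N) j                                             ≡⟨ cong (λ k → rr r k j) (ℕP.m≤n⇒m⊓n≡m K≤N) ⟩
    rr r K j                                                   ∎
  where open ≡-Reasoning

lead : Letter → Letter
lead rl      = rl
lead (num j) = num (suc j)

lead≢num0 : ∀ x → lead x ≢ num 0
lead≢num0 rl      ()
lead≢num0 (num j) ()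

lead≡rl⇒≡rl : ∀ x → lead x ≡ rl → x ≡ rl
lead≡rl⇒≡rl rl _ = refl

_≟num0 : ∀ x → Dec (x ≡ num 0)
rl          ≟num0 = no λ ()
num zero    ≟num0 = yes refl
num (suc j) ≟num0 = no λ ()

isZero : Letter → ℤ
isZero (num zero) = 1ℤ
isZero _          = 0ℤ

isZero-nonzero : ∀ x → x ≢ num 0 → isZero x ≡ 0ℤ
isZero-nonzero rl            _  = refl
isZero-nonzero (num zero)    ne = ⊥-elim (ne refl)
isZero-nonzero (num (suc j)) _  = refl

index : Letter → ℕ
index rl      = 0
index (num j) = j

index-lead : ∀ x → x ≢ rl → index (lead x) ≡ suc (index x)
index-lead rl      x≢rl = ⊥-elim (x≢rl refl)
index-lead (num j) _    = refl

index-lead≤ : ∀ x → index (lead x) ≤ suc (index x)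
index-lead≤ rl      = z≤n
index-lead≤ (num j) = ℕP.≤-refl

iter-suc-inner : ∀ (a : ℤ → ℕ) i x → iter a (suc i) x ≡ iter a i (+ a x)
iter-suc-inner a zero    x = refl
iter-suc-inner a (suc i) x = cong (λ y → + a y) (iter-suc-inner a i x)

iter-vanishes : ∀ (a : ℤ → ℕ) → a (+ 0) ≡ 0 → ∀ i x → a x ≡ 0 → iter a (suc i) x ≡ + 0
iter-vanishes a a0 zero    x ax = cong +_ ax
iter-vanishes a a0 (suc i) x ax = trans (cong (λ y → + a y) (iter-vanishes a a0 i x ax)) (cong +_ a0)

module Tree (s : ℕ) (r : ℕ → ℕ) where

  zeros : Letter → ℕ
  zeros rl      = s
  zeros (num j) = r (suc j)

  rr-lead : ∀ x j → x ≢ rl → rr r (index (lead x)) j ≡ 𝟙≤ j (zeros x)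
  rr-lead rl      j x≢rl = ⊥-elim (x≢rl refl)
  rr-lead (num k) j _    = refl

  Entry : Set
  Entry = Letter × ℕ

  infixl 9 _‼_ _!_
  _‼_ : List Entry → ℕ → Entry
  _‼_ = nth (rl , 0)

  _!_ : List Letter → ℕ → Letter
  _!_ = nth rl

  ch : ℕ → List Letter → List Entry
  ch = children s r

  children-∷ : ∀ p x xs →
    ch p (x ∷ xs) ≡ (lead x , p) ∷ (replicate (zeros x) (num 0 , p) ++ ch (suc p) xs)
  children-∷ p rl      xs = cong (λ zs → (rl , p) ∷ (zs ++ ch (suc p) xs)) (ListP.map-replicate _ s (num 0))
  children-∷ p (num j) xs = cong (λ zs → (num (suc j) , p) ∷ (zs ++ ch (suc p) xs)) (ListP.map-replicate _ (r (suc j)) (num 0))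

  children-head : ∀ p xs → proj₁ (ch p xs ‼ 0) ≢ num 0
  children-head p []       ()
  children-head p (x ∷ xs) = subst (λ L → proj₁ (L ‼ 0) ≢ num 0) (sym (children-∷ p x xs)) (lead≢num0 x)

  children-++ : ∀ p xs ys → ch p (xs ++ ys) ≡ ch p xs ++ ch (p + length xs) ys
  children-++ p []       ys = cong (λ q → ch q ys) (sym (ℕP.+-identityʳ p))
  children-++ p (x ∷ xs) ys = begin
      block ++ ch (suc p) (xs ++ ys)
    ≡⟨ cong (block ++_) (children-++ (suc p) xs ys) ⟩
      block ++ (ch (suc p) xs ++ ch (suc p + length xs) ys)
    ≡⟨ sym (ListP.++-assoc block (ch (suc p) xs) _) ⟩
      (block ++ ch (suc p) xs) ++ ch (suc p + length xs) ys
    ≡⟨ cong (λ q → ch p (x ∷ xs) ++ ch q ys) (sym (ℕP.+-suc p (length xs))) ⟩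
      ch p (x ∷ xs) ++ ch (p + suc (length xs)) ys
    ∎
    where
      open ≡-Reasoning
      block = map (λ y → y , p) (σ s r x)

  length≤children : ∀ p xs → length xs ≤ length (ch p xs)
  length-children-∷ : ∀ p x xs → zeros x + suc (length xs) ≤ length (ch p (x ∷ xs))

  length≤children p []       = z≤n
  length≤children p (x ∷ xs) = ℕP.≤-trans (ℕP.m≤n+m _ (zeros x)) (length-children-∷ p x xs)

  length-children-∷ p x xs rewrite children-∷ p x xs | length-replicate-++ (zeros x) (num 0 , p) (ch (suc p) xs) =
    ℕP.≤-trans (ℕP.≤-reflexive (ℕP.+-suc (zeros x) (length xs)))
               (s≤s (ℕP.+-monoʳ-≤ (zeros x) (length≤children (suc p) xs)))

  Successor : ℕ → List Letter → Entry → Entry → Set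
  Successor p xs (_ , u) (y , v) =
      (y ≡ num 0 × v ≡ u)
    ⊎ (v ≡ suc u × ∃[ o ] (o < length xs × v ≡ p + o × y ≡ lead (xs ! o)))

  SuccessorsIn : ℕ → List Letter → List Entry → Set
  SuccessorsIn p xs L = ∀ k → suc k < length L → Successor p xs (L ‼ k) (L ‼ suc k)

  successor-∷ : ∀ p x xs u v → Successor (suc p) xs u v → Successor p (x ∷ xs) u v
  successor-∷ p x xs u v (inj₁ same)                     = inj₁ same
  successor-∷ p x xs u v (inj₂ (next , o , o< , v≡ , y≡)) =
    inj₂ (next , suc o , s≤s o< , trans v≡ (sym (ℕP.+-suc p o)) , y≡)

  children-successors : ∀ p xs → SuccessorsIn p xs (ch p xs)
  block-successors : ∀ n p xs z → proj₂ z ≡ p →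
    SuccessorsIn (suc p) xs (z ∷ (replicate n (num 0 , p) ++ ch (suc p) xs))

  children-successors p []       k ()
  children-successors p (x ∷ xs) = subst (SuccessorsIn p (x ∷ xs)) (sym (children-∷ p x xs))
    λ k h → successor-∷ p x xs (L ‼ k) (L ‼ suc k) (block-successors (zeros x) p xs (lead x , p) refl k h)
    where L = (lead x , p) ∷ (replicate (zeros x) (num 0 , p) ++ ch (suc p) xs)

  block-successors (suc n) p xs z z≡ zero    h = inj₁ (refl , sym z≡)
  block-successors (suc n) p xs z z≡ (suc k) h = block-successors n p xs (num 0 , p) refl k (ℕP.≤-pred h)
  block-successors zero    p []        z z≡ zero    (s≤s ())
  block-successors zero    p (x ∷ xs) z z≡ zero    h =
    inj₂ (trans (cong proj₂ first) (cong suc (sym z≡)) , 0 , s≤s z≤n ,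
          trans (cong proj₂ first) (sym (ℕP.+-identityʳ (suc p))) , cong proj₁ first)
    where first = cong (_‼ 0) (children-∷ (suc p) x xs)
  block-successors zero    p xs       z z≡ (suc k) h = children-successors (suc p) xs k (ℕP.≤-pred h)

  ZeroRunAfter : List Entry → ℕ → ℕ → Set
  ZeroRunAfter L k e =
    (∀ t → 1 ≤ t → t ≤ e → k + t < length L × proj₁ (L ‼ (k + t)) ≡ num 0) ×
    (suc (k + e) < length L → proj₁ (L ‼ suc (k + e)) ≢ num 0)

  RunAt : ℕ → List Letter → List Entry → ℕ → Set
  RunAt p xs L k = proj₁ (L ‼ k) ≢ num 0 →
    ∃[ o ] (o < length xs × proj₂ (L ‼ k) ≡ p + o × ZeroRunAfter L k (zeros (xs ! o)))

  RunsIn : ℕ → List Letter → List Entry → Set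
  RunsIn p xs L = ∀ k → k < length L → RunAt p xs L k

  runs-∷ : ∀ p xs L z → RunsIn p xs L → RunAt p xs (z ∷ L) 0 → RunsIn p xs (z ∷ L)
  runs-∷ p xs L z runs run₀ zero    _  = run₀
  runs-∷ p xs L z runs run₀ (suc k) lt ne with runs k (ℕP.≤-pred lt) ne
  ... | o , o< , u≡ , zero-run , run-end =
    o , o< , u≡ , (λ t t≥1 t≤ → let (k+t< , is-zero) = zero-run t t≥1 t≤ in s≤s k+t< , is-zero) ,
    (λ lt′ → run-end (ℕP.≤-pred lt′))

  runs-shift : ∀ p x xs L → RunsIn (suc p) xs L → RunsIn p (x ∷ xs) L
  runs-shift p x xs L runs k lt ne with runs k lt ne
  ... | o , o< , u≡ , run = suc o , s≤s o< , trans u≡ (sym (ℕP.+-suc p o)) , run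

  runs-zeros : ∀ p xs L n u → RunsIn p xs L → RunsIn p xs (replicate n (num 0 , u) ++ L)
  runs-zeros p xs L zero    u runs = runs
  runs-zeros p xs L (suc n) u runs = runs-∷ p xs _ _ (runs-zeros p xs L n u runs) (λ ne → ⊥-elim (ne refl))

  children-runs : ∀ p xs → RunsIn p xs (ch p xs)
  children-runs p []       k ()
  children-runs p (x ∷ xs) = subst (RunsIn p (x ∷ xs)) (sym (children-∷ p x xs))
    (runs-∷ p (x ∷ xs) (zs ++ rest) (lead x , p)
      (runs-shift p x xs (zs ++ rest) (runs-zeros (suc p) xs rest (zeros x) p (children-runs (suc p) xs)))
      (λ _ → 0 , s≤s z≤n , sym (ℕP.+-identityʳ p) , zero-run , run-end))
    where
      zs = replicate (zeros x) (num 0 , p)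
      rest = ch (suc p) xs
      L = (lead x , p) ∷ (zs ++ rest)
      zero-run : ∀ t → 1 ≤ t → t ≤ zeros x → t < length L × proj₁ (L ‼ t) ≡ num 0
      zero-run (suc t) _ t< =
        s≤s (subst (t <_) (sym (length-replicate-++ (zeros x) _ rest)) (ℕP.≤-trans t< (ℕP.m≤m+n (zeros x) (length rest)))) ,
        cong proj₁ (nth-replicate-++ (rl , 0) (zeros x) (num 0 , p) rest t t<)
      run-end : suc (zeros x) < length L → proj₁ (L ‼ suc (zeros x)) ≢ num 0
      run-end _ = subst (λ e → proj₁ e ≢ num 0) (sym (nth-replicate-++-end (rl , 0) (zeros x) (num 0 , p) rest))
                    (children-head (suc p) xs)

  R : ℕ → List Letter
  R = row s r

  NR : ℕ → List Entry
  NR = nextRow s r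

  row-starts-with-rl : ∀ d → ∃[ zs ] R d ≡ rl ∷ zs
  row-starts-with-rl zero    = _ , refl
  row-starts-with-rl (suc d) rewrite proj₂ (row-starts-with-rl d) = _ , refl

  row-prefix : ∀ d → Prefix (R d) (R (suc d))
  row-prefix zero    = _ , refl
  row-prefix (suc d) with row-prefix d
  ... | ys , R≡ = map proj₁ (ch (0 + length (R d)) ys) , (begin
      map proj₁ (ch 0 (R (suc d)))
    ≡⟨ cong (λ xs → map proj₁ (ch 0 xs)) R≡ ⟩
      map proj₁ (ch 0 (R d ++ ys))
    ≡⟨ cong (map proj₁) (children-++ 0 (R d) ys) ⟩
      map proj₁ (ch 0 (R d) ++ ch (0 + length (R d)) ys)
    ≡⟨ ListP.map-++ proj₁ (ch 0 (R d)) _ ⟩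
      R (suc d) ++ map proj₁ (ch (0 + length (R d)) ys)
    ∎)
    where open ≡-Reasoning

  nextRow-prefix-≤′ : ∀ {d d′} → d ≤′ d′ → Prefix (NR d) (NR d′)
  nextRow-prefix-≤′ {d} ℕ.≤′-refl = [] , sym (ListP.++-identityʳ (NR d))
  nextRow-prefix-≤′ {d} (ℕ.≤′-step {d′} le) with nextRow-prefix-≤′ le | row-prefix d′
  ... | ys , NR≡ | zs , R≡ = ys ++ ch (length (R d′)) zs , (begin
      ch 0 (R (suc d′))
    ≡⟨ cong (ch 0) R≡ ⟩
      ch 0 (R d′ ++ zs)
    ≡⟨ children-++ 0 (R d′) zs ⟩
      NR d′ ++ ch (length (R d′)) zs
    ≡⟨ cong (_++ ch (length (R d′)) zs) NR≡ ⟩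
      (NR d ++ ys) ++ ch (length (R d′)) zs
    ≡⟨ ListP.++-assoc (NR d) ys _ ⟩
      NR d ++ (ys ++ ch (length (R d′)) zs)
    ∎)
    where open ≡-Reasoning

  nextRow-stable : ∀ {d d′ q} → d ≤ d′ → q < length (NR d) → NR d′ ‼ q ≡ NR d ‼ q
  nextRow-stable {d} {d′} {q} le q< with nextRow-prefix-≤′ (ℕP.≤⇒≤′ le)
  ... | ys , NR≡ = trans (cong (_‼ q) NR≡) (nth-++ˡ (rl , 0) (NR d) ys q q<)

  length-row : 1 ≤ s → ∀ d → suc d ≤ length (R d)
  length-row s≥1 zero    = s≤s z≤n
  length-row s≥1 (suc d) with row-starts-with-rl d
  ... | zs , R≡ = begin
      suc (suc d)                     ≤⟨ s≤s (subst (λ xs → suc d ≤ length xs) R≡ (length-row s≥1 d)) ⟩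
      suc (suc (length zs))           ≤⟨ ℕP.+-monoˡ-≤ (suc (length zs)) s≥1 ⟩
      s + suc (length zs)             ≤⟨ length-children-∷ 0 rl zs ⟩
      length (ch 0 (rl ∷ zs))         ≡⟨ cong (λ xs → length (ch 0 xs)) (sym R≡) ⟩
      length (NR d)                   ≡⟨ sym (ListP.length-map proj₁ (NR d)) ⟩
      length (R (suc d))              ∎
    where open ℕP.≤-Reasoning

  length-nextRow : 1 ≤ s → ∀ d → suc (suc d) ≤ length (NR d)
  length-nextRow s≥1 d = subst (suc (suc d) ≤_) (ListP.length-map proj₁ (NR d)) (length-row s≥1 (suc d))

  row-in-nextRow : ∀ d o → o < length (R d) → R d ! o ≡ proj₁ (NR d ‼ o)
  row-in-nextRow d o o< with row-prefix d
  ... | ys , R≡ = begin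
      R d ! o                  ≡⟨ sym (nth-++ˡ rl (R d) ys o o<) ⟩
      (R d ++ ys) ! o          ≡⟨ cong (_! o) (sym R≡) ⟩
      map proj₁ (NR d) ! o     ≡⟨ nth-map proj₁ (rl , 0) (NR d) o ⟩
      proj₁ (NR d ‼ o)         ∎
    where open ≡-Reasoning

  length-row≤nextRow : ∀ d → length (R d) ≤ length (NR d)
  length-row≤nextRow d with row-prefix d
  ... | ys , R≡ = subst (length (R d) ≤_) (trans (cong length (sym R≡)) (ListP.length-map proj₁ (NR d)))
                        (ListP.length-++-≤ˡ (R d))

module LevelWord (s : ℕ) (r : ℕ → ℕ) (s≥1 : 1 ≤ s) (a : ℤ → ℕ) (isA : IsA s r a) where
  open Tree s r

  -- Row q + 1 is long enough to contain position q, and every deeper row extends it.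
  label : ℕ → Letter
  label q = proj₁ (NR q ‼ q)

  A : ℕ → ℕ
  A q = a (+ q)

  q<length-nextRow : ∀ q → q < length (NR q)
  q<length-nextRow q = ℕP.≤-trans (ℕP.n≤1+n (suc q)) (length-nextRow s≥1 q)

  label-stable : ∀ d q → q < length (NR d) → proj₁ (NR d ‼ q) ≡ label q
  label-stable d q q< with ℕP.≤-total q d
  ... | inj₁ q≤d = cong proj₁ (nextRow-stable q≤d (q<length-nextRow q))
  ... | inj₂ d≤q = cong proj₁ (sym (nextRow-stable d≤q q<))

  parent-at : ∀ d q → q < length (NR d) → A q ≡ proj₂ (NR d ‼ q)
  parent-at d q q< = trans (proj₂ isA d q q<) (cong proj₂ (lookup≡nth (rl , 0) (NR d) q q<))

  row-label : ∀ d o → o < length (R d) → R d ! o ≡ label o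
  row-label d o o< = trans (row-in-nextRow d o o<) (label-stable d o (ℕP.≤-trans o< (length-row≤nextRow d)))

  A-zero : A 0 ≡ 0
  A-zero = parent-at 0 0 (s≤s z≤n)

  a-negative : ∀ k → a -[1+ k ] ≡ 0
  a-negative k = proj₁ isA -[1+ k ] ℤ.-<+

  label-step : ∀ k →
      (label (suc k) ≡ num 0 × A (suc k) ≡ A k)
    ⊎ (A (suc k) ≡ suc (A k) × label (suc k) ≡ lead (label (A (suc k))))
  label-step k with children-successors 0 (R k) k (length-nextRow s≥1 k)
  ... | inj₁ (is-zero , same) =
    inj₁ (trans (sym (label-stable k (suc k) k+1<)) is-zero ,
          trans (parent-at k (suc k) k+1<) (trans same (sym (parent-at k k k<))))
    where k+1< = length-nextRow s≥1 k
          k<   = ℕP.≤-trans (ℕP.n≤1+n (suc k)) k+1<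
  ... | inj₂ (next , o , o< , v≡o , is-lead) =
    inj₂ (trans (parent-at k (suc k) k+1<) (trans next (cong suc (sym (parent-at k k k<)))) ,
          trans (sym (label-stable k (suc k) k+1<)) (trans is-lead (cong lead (trans (row-label k o o<) (cong label A≡o)))))
    where k+1< = length-nextRow s≥1 k
          k<   = ℕP.≤-trans (ℕP.n≤1+n (suc k)) k+1<
          A≡o  = sym (trans (parent-at k (suc k) k+1<) v≡o)

  runLength : ℕ → ℕ
  runLength q = zeros (label (A q))

  zero-run-in : ∀ d q → q < length (NR d) → label q ≢ num 0 → ZeroRunAfter (NR d) q (runLength q)
  zero-run-in d q q< ne with children-runs 0 (R d) q q< (λ is-zero → ne (trans (sym (label-stable d q q<)) is-zero))
  ... | o , o< , A≡o , run = subst (ZeroRunAfter (NR d) q) (cong zeros (sym label≡)) run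
    where label≡ : label (A q) ≡ R d ! o
          label≡ = trans (cong label (trans (parent-at d q q<) A≡o)) (sym (row-label d o o<))

  run-zeros : ∀ q → label q ≢ num 0 → ∀ t → 1 ≤ t → t ≤ runLength q → label (q + t) ≡ num 0
  run-zeros q ne t t≥1 t≤ =
    let (q+t< , is-zero) = proj₁ (zero-run-in q q (q<length-nextRow q) ne) t t≥1 t≤
    in trans (sym (label-stable q (q + t) q+t<)) is-zero

  run-end : ∀ q → label q ≢ num 0 → label (suc (q + runLength q)) ≢ num 0
  run-end q ne is-zero =
    proj₂ (zero-run-in m q q< ne) m< (trans (label-stable m m m<) is-zero)
    where m  = suc (q + runLength q)
          m< = q<length-nextRow m
          q< = ℕP.≤-<-trans (ℕP.≤-trans (ℕP.m≤m+n q (runLength q)) (ℕP.n≤1+n _)) m<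

module Recurrence (s : ℕ) (r : ℕ → ℕ) (s≥1 : 1 ≤ s) (a : ℤ → ℕ) (isA : IsA s r a) where
  open Tree s r using (zeros; rr-lead)
  open LevelWord s r s≥1 a isA

  A-initial : ∀ t → t ≤ s → A t ≡ 0
  A-initial zero    _   = A-zero
  A-initial (suc t) t<s with label-step t
  ... | inj₁ (_ , same)    = trans same (A-initial t (ℕP.≤-trans (ℕP.n≤1+n t) t<s))
  ... | inj₂ (_ , is-lead) = ⊥-elim (lead≢num0 _ (trans (sym is-lead) (run-zeros 0 (λ ()) (suc t) (s≤s z≤n) t<run)))
    where t<run = subst (λ p → suc t ≤ zeros (label p)) (sym A-zero) t<s

  A-suc≤ : ∀ k → A (suc k) ≤ k
  A-suc≤ zero    = ℕP.≤-reflexive (A-initial 1 s≥1)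
  A-suc≤ (suc k) with label-step (suc k)
  ... | inj₁ (_ , same) = ℕP.≤-trans (ℕP.≤-reflexive same) (ℕP.≤-trans (A-suc≤ k) (ℕP.n≤1+n k))
  ... | inj₂ (next , _) = subst (_≤ suc k) (sym next) (s≤s (A-suc≤ k))

  first-child : ∀ q → label (suc q) ≢ num 0 → A (suc q) ≡ suc (A q) × label (suc q) ≡ lead (label (A (suc q)))
  first-child q ne with label-step q
  ... | inj₁ (is-zero , _) = ⊥-elim (ne is-zero)
  ... | inj₂ first         = first

  label≡rl⇒≡0 : ∀ q → label q ≡ rl → q ≡ 0
  label≡rl⇒≡0 = <-rec _ go
    where
      go : ∀ q → (∀ {p} → p < q → label p ≡ rl → p ≡ 0) → label q ≡ rl → q ≡ 0
      go zero    _   _     = refl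
      go (suc k) rec is-rl with first-child k (subst (_≢ num 0) (sym is-rl) (λ ()))
      ... | next , is-lead =
        ⊥-elim (ℕP.1+n≢0 (trans (sym next) (rec (s≤s (A-suc≤ k)) (lead≡rl⇒≡rl _ (trans (sym is-lead) is-rl)))))

  label-suc≢rl : ∀ q → label (suc q) ≢ rl
  label-suc≢rl q is-rl with label≡rl⇒≡0 (suc q) is-rl
  ... | ()

  level : ℕ → ℕ
  level q = index (label q)

  level-first-child : ∀ q → label (suc q) ≢ num 0 → level (suc q) ≡ suc (level (A (suc q)))
  level-first-child q ne with first-child q ne
  ... | next , is-lead = trans (cong index is-lead)
      (index-lead _ (subst (λ p → label p ≢ rl) (sym next) (label-suc≢rl (A q))))

  level≤ : ∀ q → level q ≤ q
  level≤ = <-rec _ go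
    where
      go : ∀ q → (∀ {p} → p < q → level p ≤ p) → level q ≤ q
      go zero    _   = z≤n
      go (suc k) rec with label-step k
      ... | inj₁ (is-zero , _) = subst (λ x → index x ≤ suc k) (sym is-zero) z≤n
      ... | inj₂ (_ , is-lead) = begin
          level (suc k)                      ≡⟨ cong index is-lead ⟩
          index (lead (label (A (suc k))))   ≤⟨ index-lead≤ (label (A (suc k))) ⟩
          suc (level (A (suc k)))            ≤⟨ s≤s (rec (s≤s (A-suc≤ k))) ⟩
          suc (A (suc k))                    ≤⟨ s≤s (A-suc≤ k) ⟩
          suc k                              ∎
        where open ℕP.≤-Reasoning

  levelℤ : ℤ → ℕ
  levelℤ (+ q)      = level q
  levelℤ -[1+ _ ]   = 0

  iter-level : ∀ i x → iter a i (x ℤ.+ 1ℤ) ≡ iter a i x ℤ.+ 𝟙≤ i (levelℤ (x ℤ.+ 1ℤ))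
  iter-level-suc : ∀ i q → iter a (suc i) (+ suc q) ≡ iter a (suc i) (+ q) ℤ.+ 𝟙≤ (suc i) (level (suc q))

  iter-level zero    x                = refl
  iter-level (suc i) (+ q)            =
    subst (λ p → iter a (suc i) (+ p) ≡ iter a (suc i) (+ q) ℤ.+ 𝟙≤ (suc i) (level p))
          (ℕP.+-comm 1 q) (iter-level-suc i q)
  iter-level (suc i) -[1+ zero ]      =
    trans (iter-vanishes a A-zero i (+ 0) A-zero)
          (sym (cong (ℤ._+ 0ℤ) (iter-vanishes a A-zero i -[1+ 0 ] (a-negative 0))))
  iter-level (suc i) -[1+ suc k ]     =
    trans (iter-vanishes a A-zero i -[1+ k ] (a-negative k))
          (sym (cong (ℤ._+ 0ℤ) (iter-vanishes a A-zero i -[1+ suc k ] (a-negative (suc k)))))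

  iter-level-suc i q with label-step q
  ... | inj₁ (is-zero , same) = begin
      iter a (suc i) (+ suc q)                    ≡⟨ iter-suc-inner a i (+ suc q) ⟩
      iter a i (+ A (suc q))                      ≡⟨ cong (λ p → iter a i (+ p)) same ⟩
      iter a i (+ A q)                            ≡⟨ sym (iter-suc-inner a i (+ q)) ⟩
      iter a (suc i) (+ q)                        ≡⟨ sym (ℤP.+-identityʳ _) ⟩
      iter a (suc i) (+ q) ℤ.+ 0ℤ                 ≡⟨ cong (λ x → iter a (suc i) (+ q) ℤ.+ 𝟙≤ (suc i) (index x)) (sym is-zero) ⟩
      iter a (suc i) (+ q) ℤ.+ 𝟙≤ (suc i) (level (suc q)) ∎
    where open ≡-Reasoning
  ... | inj₂ (next , is-lead) = begin
      iter a (suc i) (+ suc q)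
    ≡⟨ iter-suc-inner a i (+ suc q) ⟩
      iter a i (+ A (suc q))
    ≡⟨ cong (iter a i) (sym A+1) ⟩
      iter a i (+ A q ℤ.+ 1ℤ)
    ≡⟨ iter-level i (+ A q) ⟩
      iter a i (+ A q) ℤ.+ 𝟙≤ i (levelℤ (+ A q ℤ.+ 1ℤ))
    ≡⟨ cong₂ ℤ._+_ (sym (iter-suc-inner a i (+ q))) (cong (λ x → 𝟙≤ i (levelℤ x)) A+1) ⟩
      iter a (suc i) (+ q) ℤ.+ 𝟙≤ i (level (A (suc q)))
    ≡⟨ cong (λ z → iter a (suc i) (+ q) ℤ.+ z) (sym (𝟙≤-suc i _)) ⟩
      iter a (suc i) (+ q) ℤ.+ 𝟙≤ (suc i) (suc (level (A (suc q))))
    ≡⟨ cong (λ k → iter a (suc i) (+ q) ℤ.+ 𝟙≤ (suc i) k) (sym (level-first-child q nonzero)) ⟩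
      iter a (suc i) (+ q) ℤ.+ 𝟙≤ (suc i) (level (suc q))
    ∎
    where
      open ≡-Reasoning
      A+1 : + A q ℤ.+ 1ℤ ≡ + A (suc q)
      A+1 = cong +_ (trans (ℕP.+-comm (A q) 1) (sym next))
      nonzero : label (suc q) ≢ num 0
      nonzero = subst (_≢ num 0) (sym is-lead) (lead≢num0 _)

  levelℤ-diff : ∀ q j → levelℤ (+ q - + j) ≡ level (q ∸ j)
  levelℤ-diff q j with ℕP.≤-total j q
  ... | inj₁ j≤q = cong levelℤ ([+m]-[+n]≡+[m∸n] j≤q)
  ... | inj₂ q≤j rewrite [+m]-[+n]≡-[n∸m] q≤j | ℕP.m≤n⇒m∸n≡0 q≤j = levelℤ-neg (j ∸ q)
    where levelℤ-neg : ∀ m → levelℤ (ℤ.- + m) ≡ 0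
          levelℤ-neg zero    = refl
          levelℤ-neg (suc m) = refl

  run-term : ∀ m j → 1 ≤ m → label m ≢ num 0 → rr r (level m) j ≡ 𝟙≤ j (runLength m)
  run-term (suc m) j _ ne with first-child m ne
  ... | next , is-lead = trans (cong (λ x → rr r (index x) j) is-lead)
      (rr-lead _ j (subst (λ p → label p ≢ rl) (sym next) (label-suc≢rl (A m))))

  record LastNonzero (q m : ℕ) : Set where
    field
      ≤q          : m ≤ q
      nonzero     : label m ≢ num 0
      zeros-after : ∀ t → m < t → t ≤ q → label t ≡ num 0

  last-nonzero-here : ∀ q → label q ≢ num 0 → LastNonzero q q
  last-nonzero-here q ne = record
    { ≤q = ℕP.≤-refl ; nonzero = ne ; zeros-after = λ t q<t t≤q → ⊥-elim (ℕP.<⇒≱ q<t t≤q) }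

  last-nonzero : ∀ q → ∃[ m ] LastNonzero q m
  last-nonzero zero = 0 , last-nonzero-here 0 (λ ())
  last-nonzero (suc q) with label (suc q) ≟num0
  ... | no ne = suc q , last-nonzero-here (suc q) ne
  ... | yes is-zero with last-nonzero q
  ...   | m , last = m , record
      { ≤q          = ℕP.m≤n⇒m≤1+n ≤q
      ; nonzero     = nonzero
      ; zeros-after = λ t m<t t≤q+1 → case (ℕP.m≤n⇒m<n∨m≡n t≤q+1) m<t
      }
    where
      open LastNonzero last
      case : ∀ {t} → t < suc q ⊎ t ≡ suc q → m < t → label t ≡ num 0
      case (inj₁ t<) m<t = zeros-after _ m<t (ℕP.≤-pred t<)
      case (inj₂ refl) _ = is-zero

  label-suc-s≢num0 : label (suc s) ≢ num 0
  label-suc-s≢num0 = subst (λ p → label (suc (zeros (label p))) ≢ num 0) A-zero (run-end 0 (λ ()))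

  module _ {q m : ℕ} (last : LastNonzero q m) where
    open LastNonzero last

    -- A run starting before the last nonzero letter m cannot reach past m.
    run-term-off : ∀ j → 1 ≤ j → j ≢ q ∸ m → rr r (level (q ∸ j)) j ≡ 0ℤ
    run-term-off j j≥1 j≢ with q ≤? j
    ... | yes q≤j rewrite ℕP.m≤n⇒m∸n≡0 q≤j = refl
    ... | no  q≰j with label (q ∸ j) ≟num0
    ...   | yes is-zero = cong (λ x → rr r (index x) j) is-zero
    ...   | no  ne with j ≤? runLength (q ∸ j)
    ...     | no  j≰ = trans (run-term (q ∸ j) j (ℕP.m<n⇒0<n∸m j<q) ne) (𝟙≤-> (ℕP.≰⇒> j≰))
      where j<q = ℕP.≰⇒> q≰j
    ...     | yes j≤ with ℕP.<-cmp (q ∸ j) m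
    ...       | tri< p<m _ _ = ⊥-elim (nonzero (subst (λ t → label t ≡ num 0) (ℕP.m+[n∸m]≡n (ℕP.<⇒≤ p<m))
                                 (run-zeros (q ∸ j) ne (m ∸ (q ∸ j)) (ℕP.m<n⇒0<n∸m p<m) m-p≤run)))
      where
        j<q = ℕP.≰⇒> q≰j
        m-p≤run : m ∸ (q ∸ j) ≤ runLength (q ∸ j)
        m-p≤run = begin
          m ∸ (q ∸ j)        ≤⟨ ℕP.∸-monoˡ-≤ (q ∸ j) ≤q ⟩
          q ∸ (q ∸ j)        ≡⟨ ℕP.m∸[m∸n]≡n (ℕP.<⇒≤ j<q) ⟩
          j                  ≤⟨ j≤ ⟩
          runLength (q ∸ j)  ∎
          where open ℕP.≤-Reasoning
    ...       | tri≈ _ p≡m _ =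
      ⊥-elim (j≢ (trans (sym (ℕP.m∸[m∸n]≡n (ℕP.<⇒≤ (ℕP.≰⇒> q≰j)))) (cong (q ∸_) p≡m)))
    ...       | tri> _ _ m<p = ⊥-elim (ne (zeros-after (q ∸ j) m<p (ℕP.m∸n≤m q j)))

    run-term-on : 1 ≤ m → m < q → rr r (level m) (q ∸ m) ≡ 1ℤ
    run-term-on m≥1 m<q with q ∸ m ≤? runLength m
    ... | yes ≤run = trans (run-term m (q ∸ m) m≥1 nonzero) (𝟙≤-≤ ≤run)
    ... | no  ≰run = ⊥-elim (run-end m nonzero (zeros-after _ (s≤s (ℕP.m≤m+n m _)) past-run))
      where
        past-run : suc (m + runLength m) ≤ q
        past-run = begin
          suc (m + runLength m)   ≡⟨ sym (ℕP.+-suc m _) ⟩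
          m + suc (runLength m)   ≤⟨ ℕP.+-monoʳ-≤ m (ℕP.≰⇒> ≰run) ⟩
          m + (q ∸ m)             ≡⟨ ℕP.m+[n∸m]≡n (ℕP.<⇒≤ m<q) ⟩
          q                       ∎
          where open ℕP.≤-Reasoning

  zeros-counted : ∀ q N → s < q → q ≤ N → sum1 N (λ j → rr r (level (q ∸ j)) j) ≡ isZero (label q)
  zeros-counted q N s<q q≤N with last-nonzero q
  ... | m , last with ℕP.m≤n⇒m<n∨m≡n (LastNonzero.≤q last)
  ...   | inj₂ refl = trans (sum1-zero N (λ j j≥1 _ → run-term-off last j j≥1 (j≢0 j≥1)))
                            (sym (isZero-nonzero _ (LastNonzero.nonzero last)))
    where j≢0 : ∀ {j} → 1 ≤ j → j ≢ q ∸ q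
          j≢0 j≥1 j≡ = ℕP.<⇒≢ j≥1 (sym (trans j≡ (ℕP.n∸n≡0 q)))
  ...   | inj₁ m<q = begin
      sum1 N (λ j → rr r (level (q ∸ j)) j)  ≡⟨ sum1-single N (q ∸ m) (ℕP.m<n⇒0<n∸m m<q) (ℕP.≤-trans (ℕP.m∸n≤m q m) q≤N)
                                                   (λ j j≥1 _ → run-term-off last j j≥1) ⟩
      rr r (level (q ∸ (q ∸ m))) (q ∸ m)     ≡⟨ cong (λ p → rr r (level p) (q ∸ m)) (ℕP.m∸[m∸n]≡n (ℕP.<⇒≤ m<q)) ⟩
      rr r (level m) (q ∸ m)                 ≡⟨ run-term-on last (ℕP.≤-trans (s≤s z≤n) s<m) m<q ⟩
      1ℤ                                     ≡⟨ cong isZero (sym (LastNonzero.zeros-after last q m<q ℕP.≤-refl)) ⟩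
      isZero (label q)                       ∎
    where
      open ≡-Reasoning
      s<m : s < m
      s<m = ℕP.≰⇒> (λ m≤s → label-suc-s≢num0 (LastNonzero.zeros-after last (suc s) (s≤s m≤s) s<q))

  correction : ℕ → ℕ → ℤ
  correction N n = sum1 N (λ i → sum1 N (λ j → c r i j * iter a i (+ n - + j)))

  correction-suc : ∀ N n → suc n ≤ N →
    correction N (suc n) ≡ correction N n ℤ.+ sum1 N (λ j → rr r (level (suc n ∸ j)) j)
  correction-suc N n n<N = begin
      correction N (suc n)
    ≡⟨ sum1-cong N (λ i _ _ → sum1-cong N (λ j _ _ → term-suc i j)) ⟩
      sum1 N (λ i → sum1 N (λ j → c r i j * iter a i (+ n - + j) ℤ.+ c r i j * 𝟙≤ i (K j)))
    ≡⟨ sum1-cong N (λ i _ _ → sum1-+ N (λ j → c r i j * iter a i (+ n - + j)) (λ j → c r i j * 𝟙≤ i (K j))) ⟩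
      sum1 N (λ i → sum1 N (λ j → c r i j * iter a i (+ n - + j)) ℤ.+ sum1 N (λ j → c r i j * 𝟙≤ i (K j)))
    ≡⟨ sum1-+ N _ _ ⟩
      correction N n ℤ.+ sum1 N (λ i → sum1 N (λ j → c r i j * 𝟙≤ i (K j)))
    ≡⟨ cong (λ x → correction N n ℤ.+ x) (sum1-swap N N (λ i j → c r i j * 𝟙≤ i (K j))) ⟩
      correction N n ℤ.+ sum1 N (λ j → sum1 N (λ i → c r i j * 𝟙≤ i (K j)))
    ≡⟨ cong (λ x → correction N n ℤ.+ x) (sum1-cong N (λ j _ _ → c-telescope r N j (K j) (K≤N j))) ⟩
      correction N n ℤ.+ sum1 N (λ j → rr r (K j) j)
    ∎
    where
      open ≡-Reasoning
      K : ℕ → ℕ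
      K j = level (suc n ∸ j)
      K≤N : ∀ j → K j ≤ N
      K≤N j = ℕP.≤-trans (level≤ (suc n ∸ j)) (ℕP.≤-trans (ℕP.m∸n≤m (suc n) j) n<N)
      iter-suc-diff : ∀ i j → iter a i (+ suc n - + j) ≡ iter a i (+ n - + j) ℤ.+ 𝟙≤ i (K j)
      iter-suc-diff i j = begin
          iter a i (+ suc n - + j)
        ≡⟨ cong (iter a i) ([+1+m]-[+n]≡[+m]-[+n]+1 n j) ⟩
          iter a i ((+ n - + j) ℤ.+ 1ℤ)
        ≡⟨ iter-level i (+ n - + j) ⟩
          iter a i (+ n - + j) ℤ.+ 𝟙≤ i (levelℤ ((+ n - + j) ℤ.+ 1ℤ))
        ≡⟨ cong (λ x → iter a i (+ n - + j) ℤ.+ 𝟙≤ i (levelℤ x)) (sym ([+1+m]-[+n]≡[+m]-[+n]+1 n j)) ⟩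
          iter a i (+ n - + j) ℤ.+ 𝟙≤ i (levelℤ (+ suc n - + j))
        ≡⟨ cong (λ k → iter a i (+ n - + j) ℤ.+ 𝟙≤ i k) (levelℤ-diff (suc n) j) ⟩
          iter a i (+ n - + j) ℤ.+ 𝟙≤ i (K j)
        ∎
      term-suc : ∀ i j →
        c r i j * iter a i (+ suc n - + j) ≡ c r i j * iter a i (+ n - + j) ℤ.+ c r i j * 𝟙≤ i (K j)
      term-suc i j = trans (cong (c r i j *_) (iter-suc-diff i j)) (ℤP.*-distribˡ-+ (c r i j) _ _)

  a-nonpositive : ∀ m → a (ℤ.- + m) ≡ 0
  a-nonpositive zero    = A-zero
  a-nonpositive (suc m) = a-negative m

  correction-s : ∀ N → correction N s ≡ 0ℤ
  correction-s N = sum1-zero N λ { (suc i) _ _ → sum1-zero N λ j _ _ →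
    trans (cong (c r (suc i) j *_) (iter-vanishes a A-zero i _ (a-s-diff j))) (ℤP.*-zeroʳ (c r (suc i) j)) }
    where
      a-s-diff : ∀ j → a (+ s - + j) ≡ 0
      a-s-diff j with ℕP.≤-total j s
      ... | inj₁ j≤s = trans (cong a ([+m]-[+n]≡+[m∸n] j≤s)) (A-initial (s ∸ j) (ℕP.m∸n≤m s j))
      ... | inj₂ s≤j = trans (cong a ([+m]-[+n]≡-[n∸m] s≤j)) (a-nonpositive (j ∸ s))

  A-suc : ∀ n → + A (suc n) ≡ + A n ℤ.+ 1ℤ - isZero (label (suc n))
  A-suc n with label-step n
  ... | inj₁ (is-zero , same) rewrite is-zero | same =
    solve 1 (λ x → x := x :+ con 1ℤ :- con 1ℤ) refl (+ A n)
    where open +-*-Solver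
  ... | inj₂ (next , is-lead) rewrite is-lead | next | isZero-nonzero _ (lead≢num0 (label (suc (A n)))) =
    solve 1 (λ x → con 1ℤ :+ x := x :+ con 1ℤ :- con 0ℤ) refl (+ A n)
    where open +-*-Solver

  formula-s : ∀ N → + A s ≡ (+ s - + s) - correction N s
  formula-s N = begin
    + A s                          ≡⟨ cong +_ (A-initial s ℕP.≤-refl) ⟩
    0ℤ                             ≡⟨ sym (ℤP.+-inverseʳ (+ s)) ⟩
    + s - + s                      ≡⟨ sym (ℤP.+-identityʳ _) ⟩
    (+ s - + s) - 0ℤ               ≡⟨ cong (λ x → (+ s - + s) - x) (sym (correction-s N)) ⟩
    (+ s - + s) - correction N s   ∎
    where open ≡-Reasoning

  formula : ∀ N n → s ≤ n → n ≤ N → + A n ≡ (+ n - + s) - correction N n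
  formula N zero    s≤0 _   = ⊥-elim (ℕP.<⇒≱ s≥1 s≤0)
  formula N (suc n) s≤n+1 n<N with s ≤? n
  ... | no  s≰n = subst (λ p → + A p ≡ (+ p - + s) - correction N p)
                        (ℕP.≤-antisym s≤n+1 (ℕP.≰⇒> s≰n)) (formula-s N)
  ... | yes s≤n = begin
      + A (suc n)
    ≡⟨ A-suc n ⟩
      + A n ℤ.+ 1ℤ - isZero (label (suc n))
    ≡⟨ cong (λ x → x ℤ.+ 1ℤ - isZero (label (suc n))) (formula N n s≤n (ℕP.<⇒≤ n<N)) ⟩
      (+ n - + s) - correction N n ℤ.+ 1ℤ - isZero (label (suc n))
    ≡⟨ solve 4 (λ x y z w → x :- y :- z :+ con 1ℤ :- w := (con 1ℤ :+ x) :- y :- (z :+ w))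
               refl (+ n) (+ s) (correction N n) (isZero (label (suc n))) ⟩
      (+ suc n - + s) - (correction N n ℤ.+ isZero (label (suc n)))
    ≡⟨ cong (λ x → (+ suc n - + s) - (correction N n ℤ.+ x)) (sym (zeros-counted (suc n) N (s≤s s≤n) n<N)) ⟩
      (+ suc n - + s) - (correction N n ℤ.+ sum1 N (λ j → rr r (level (suc n ∸ j)) j))
    ≡⟨ cong (λ x → (+ suc n - + s) - x) (sym (correction-suc N n n<N)) ⟩
      (+ suc n - + s) - correction N (suc n)
    ∎
    where open ≡-Reasoning; open +-*-Solver

theorem4 : (s : ℕ) (r : ℕ → ℕ) → 1 ≤ s → (a : ℤ → ℕ) → IsA s r a →
    ((n : ℕ) → n < s → a (+ n) ≡ 0) ×
    ((n : ℕ) → s ≤ n → (N : ℕ) → n ≤ N →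
      + a (+ n) ≡ (+ n - + s) - sum1 N (λ i → sum1 N (λ j → c r i j * iter a i (+ n - + j))))
theorem4 s r s≥1 a isA = (λ n n<s → A-initial n (ℕP.<⇒≤ n<s)) , (λ n s≤n N n≤N → formula N n s≤n n≤N)
  where open Recurrence s r s≥1 a isA
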